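{- The branch structure $\mathcal{M}_{\mathcal{B}}=\langle U,D,\tilde\neg,\tilde\to,\tilde\equiv\rangle$ defined in the context is an $\mathsf{SCI}$-model.
   Context: An SCI-model is a structure $\langle U,D,\tilde\neg,\tilde\to,\tilde\equiv\rangle$ with $U\neq\emptyset$, $D\subseteq U$, functions $\tilde\neg:U\to U$, $\tilde\to,\tilde\equiv:U\times U\to U$ such that for all $a,b\in U$: $\tilde\neg a\in D$ iff $a\notin D$; $a\tilde\to b\in D$ iff $a\notin D$ or $b\in D$; $a\tilde\equiv b\in D$ iff $a=b$. SCI-formulas: over a countably infinite set $\mathsf{AF}$ of atoms, $\varphi ::= p \mid \neg\varphi \mid \varphi\to\varphi \mid \varphi\equiv\varphi$; $\mathsf{FOR}$ is the set of formulas. Tableau system $\mathsf{TC}_{\mathsf{SCI}}$. Let $\mathsf{L}^+,\mathsf{L}^-$ be disjoint countably infinite sets of labels, $\mathsf{L}=\mathsf{L}^+\cup\mathsf{L}^-$; a label written $w^+$ lies in $\mathsf{L}^+$, $w^-$ in $\mathsf{L}^-$, unsuperscripted labels are arbitrary. A labelled formula is $w:\varphi$; equality statements $w=v$ and inequality statements $w\neq v$ may also occur. A tableau is a tree whose nodes carry these items or $\bot$; a branch is a root-to-leaf path identified with its set of items. Rules (premises / alternative conclusion sets separated by $\mid$): decomposition rules (conclusion labels fresh on the branch): $(\neg^+)$ $w^+:\neg\varphi$ / $v^-:\varphi$; $(\neg^-)$ $w^-:\neg\varphi$ / $v^+:\varphi$; $(\to^+)$ $w^+:\varphi\to\psi$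 / $\{v^-:\varphi,u^-:\psi\}\mid\{v^-:\varphi,u^+:\psi\}\mid\{v^+:\varphi,u^+:\psi\}$; $(\to^-)$ $w^-:\varphi\to\psi$ / $\{v^+:\varphi,u^-:\psi\}$; $(\equiv^+)$ $w^+:\varphi\equiv\psi$ / $\{v^+:\varphi,u^+:\psi,v^+=u^+\}\mid\{v^-:\varphi,u^-:\psi,v^-=u^-\}$; $(\equiv^-)$ $w^-:\varphi\equiv\psi$ / $\{v^+:\varphi,u^+:\psi,v^+\neq u^+\}\mid\{v^+:\varphi,u^-:\psi\}\mid\{v^-:\varphi,u^+:\psi\}\mid\{v^-:\varphi,u^-:\psi,v^-\neq u^-\}$. Equality rules, with $\varphi\approx\psi$ abbreviating premises $w:\varphi$, $v:\psi$, $w=v$: $(\equiv^\neg)$ $\varphi\approx\psi$, $u:\neg\varphi$, $y:\neg\psi$ / $u=y$; $(\equiv^\to)$ $\varphi\approx\psi$, $\chi\approx\theta$, $x:\varphi\to\chi$, $z:\psi\to\theta$ / $x=z$; $(\equiv^\equiv)$ $\varphi\approx\psi$, $\chi\approx\theta$, $x:\varphi\equiv\chi$, $z:\psi\equiv\theta$ / $x=z$; $(\mathsf F)$ $w:\varphi$, $v:\varphi$ / $w=v$; $(\mathsf{sym})$ $w=v$ / $v=w$; $(\mathsf{tran})$ $w=v$, $v=u$ / $w=u$. Closure rules: $(\bot_1)$ $w=v$, $w\neq v$ / $\bot$; $(\bot_2)$ $w^+=v^-$ / $\bot$. A decomposition rule may be applied to $w:\varphi$ on a branch only once; an equality rule only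 if its conclusion is not yet on the branch; closure rules are applied eagerly. A branch is closed if a closure rule was applied on it, open otherwise; fully expanded if closed or no rule is applicable. Branch structure. Let $\varphi\in\mathsf{FOR}$, $\mathbf{w}^-\in\mathsf{L}^-$, and $\mathcal{B}$ an open fully expanded branch of a tableau with root $\mathbf{w}^-:\varphi$. $\mathsf{L}_{\mathcal{B}}$ is the set of labels $w$ with $w:\psi$ on $\mathcal{B}$ for some $\psi$; $\mathsf{L}_{\mathcal{B}}^\pm=\mathsf{L}_{\mathcal{B}}\cap\mathsf{L}^\pm$; $w\sim v$ iff $w=v$ occurs on $\mathcal{B}$ (an equivalence relation on $\mathsf{L}_{\mathcal{B}}$ never relating a label in $\mathsf{L}^+$ to one in $\mathsf{L}^-$). $\mathsf{ML}_{\mathcal{B}}^+$ contains exactly one label from each $\sim$-class of $\mathsf{L}_{\mathcal{B}}^+$; $\mathsf{ML}_{\mathcal{B}}^-$ exactly one label from each $\sim$-class of $\mathsf{L}_{\mathcal{B}}^-$, chosen with $\mathbf{w}^-\in\mathsf{ML}_{\mathcal{B}}^-$; $\mathsf{ML}_{\mathcal{B}}=\mathsf{ML}_{\mathcal{B}}^+\cup\mathsf{ML}_{\mathcal{B}}^-$. Let $\mathbf{w}^+$ be an object not in $\mathsf{L}_{\mathcal{B}}$; for $w\in U$ and a label $t$, "$w\sim t$" is false if $w=\mathbf{w}^+$. $w\in\mathsf{ML}_{\mathcal{B}}$ is $(\neg)$-closed if there are $\psi\in\mathsf{FOR}$, $u\in\mathsf{ML}_{\mathcal{B}}$, $v,t\in\mathsf{L}_{\mathcal{B}}$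 with $w\sim v$, $u\sim t$, and $v:\psi$, $t:\neg\psi$ on $\mathcal{B}$. For $\#\in\{\to,\equiv\}$, a pair $(w,v)\in\mathsf{ML}_{\mathcal{B}}^2$ is $(\#)$-closed if there are $\psi,\theta\in\mathsf{FOR}$, $u\in\mathsf{ML}_{\mathcal{B}}$, $t,x,y\in\mathsf{L}_{\mathcal{B}}$ with $w\sim t$, $v\sim x$, $u\sim y$ and $t:\psi$, $x:\theta$, $y:(\psi\#\theta)$ on $\mathcal{B}$ ($\mathbf{w}^+$ is never $(\neg)$-closed, and pairs involving it are never closed). Set $D=\mathsf{ML}_{\mathcal{B}}^+\cup\{\mathbf{w}^+\}$, $U=D\cup\mathsf{ML}_{\mathcal{B}}^-$. For $w,v\in U$: $\tilde\neg w=u\in\mathsf{ML}_{\mathcal{B}}$ if there are $\psi$ and $v',t\in\mathsf{L}_{\mathcal{B}}$ with $w\sim v'$, $u\sim t$, $v':\psi$ and $t:\neg\psi$ on $\mathcal{B}$; $\tilde\neg w=\mathbf{w}^+$ if $w$ is not $(\neg)$-closed and $w\notin D$; $\tilde\neg w=\mathbf{w}^-$ otherwise. $w\tilde\to v=u\in\mathsf{ML}_{\mathcal{B}}$ if there are $\psi,\theta$ and $t,x,y\in\mathsf{L}_{\mathcal{B}}$ with $w\sim t$, $v\sim x$, $u\sim y$, $t:\psi$, $x:\theta$, $y:(\psi\to\theta)$ on $\mathcal{B}$; $w\tilde\to v=\mathbf{w}^+$ if $v=\mathbf{w}^+$, or ($w=\mathbf{w}^+$ and $v\in D$), or ($(w,v)$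 is not $(\to)$-closed and ($w\notin D$ or $v\in D$)); $w\tilde\to v=\mathbf{w}^-$ otherwise. $w\tilde\equiv v=u\in\mathsf{ML}_{\mathcal{B}}$ if there are $\psi,\theta$ and $t,x,y\in\mathsf{L}_{\mathcal{B}}$ with $w\sim t$, $v\sim x$, $u\sim y$, $t:\psi$, $x:\theta$, $y:(\psi\equiv\theta)$ on $\mathcal{B}$; $w\tilde\equiv v=\mathbf{w}^+$ if $w=v$ and ($w=\mathbf{w}^+$ or $(w,v)$ is not $(\equiv)$-closed); $w\tilde\equiv v=\mathbf{w}^-$ otherwise. $\mathcal{M}_{\mathcal{B}}=\langle U,D,\tilde\neg,\tilde\to,\tilde\equiv\rangle$. -}

module Defs where

open import Data.Nat using (ℕ)
open import Data.List using (List; []; _∷_; _++_)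
open import Data.List.Membership.Propositional using (_∈_; _∉_)
open import Data.List.Relation.Unary.Any using (Any)
open import Data.Product using (Σ; ∃; _×_; _,_; ∃-syntax)
open import Data.Sum using (_⊎_)
open import Data.Empty using (⊥)
open import Data.Unit using (⊤)
open import Relation.Nullary using (¬_)
open import Relation.Binary.PropositionalEquality using (_≡_; _≢_)

-- The operations are given by their graphs (relations on a
-- carrier type A restricted to the subset U); "being an SCI-model"
-- includes that each graph is a total function U → U (resp. U×U → U).

record IsSCIModel {A : Set} (U D : A → Set) (N : A → A → Set)
                  (I E : A → A → A → Set) : Set where
  field
    nonempty : ∃[ a ] U a
    D⊆U      : ∀ a → D a → U a
    N-total  : ∀ a → U a → ∃[ b ] (U b × N a b)
    N-func   : ∀ a b b' → U a → N a b → N a b' → b ≡ b'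
    I-total  : ∀ a b → U a → U b → ∃[ c ] (U c × I a b c)
    I-func   : ∀ a b c c' → U a → U b → I a b c → I a b c' → c ≡ c'
    E-total  : ∀ a b → U a → U b → ∃[ c ] (U c × E a b c)
    E-func   : ∀ a b c c' → U a → U b → E a b c → E a b c' → c ≡ c'
    N-sem₁   : ∀ a b → U a → N a b → D b → ¬ D a
    N-sem₂   : ∀ a b → U a → N a b → ¬ D a → D b
    I-sem₁   : ∀ a b c → U a → U b → I a b c → D c → (¬ D a ⊎ D b)
    I-sem₂   : ∀ a b c → U a → U b → I a b c → (¬ D a ⊎ D b) → D c
    E-sem₁   : ∀ a b c → U a → U b → E a b c → D c → a ≡ b
    E-sem₂   : ∀ a b c → U a → U b → E a b c → a ≡ b → D c

infixr 9 ¬ᶠ_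
infixr 8 _⇒_
infixr 8 _≡ᶠ_

data Fm : Set where
  atom : ℕ → Fm
  ¬ᶠ_  : Fm → Fm
  _⇒_  : Fm → Fm → Fm
  _≡ᶠ_ : Fm → Fm → Fm

data Label : Set where
  pl : ℕ → Label
  mi : ℕ → Label

SameSign : Label → Label → Set
SameSign (pl _) (pl _) = ⊤
SameSign (mi _) (mi _) = ⊤
SameSign _      _      = ⊥

infix 6 _∶_ _≐_ _≠ᵢ_
data Item : Set where
  _∶_  : Label → Fm → Item
  _≐_  : Label → Label → Item
  _≠ᵢ_ : Label → Label → Item
  ⊥ᵢ   : Item

Mentions : Label → Item → Set
Mentions l (v ∶ _)  = l ≡ v
Mentions l (v ≐ u)  = l ≡ v ⊎ l ≡ u
Mentions l (v ≠ᵢ u) = l ≡ v ⊎ l ≡ u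
Mentions l ⊥ᵢ       = ⊥

Fresh : Label → List Item → Set
Fresh l B = ¬ Any (Mentions l) B

Fresh₂ : Label → Label → List Item → Set
Fresh₂ v u B = Fresh v B × Fresh u B × v ≢ u

-- The state of a branch: its items, and the labelled formulas to which a
-- decomposition rule has already been applied.
record St : Set where
  constructor st
  field
    items : List Item
    done  : List (Label × Fm)
open St public

-- Alternative conclusion sets of the decomposition rules applied to w : φ
-- on branch B (conclusion labels fresh on the branch).
data Concl : Label → Fm → List Item → List Item → Set where
  c¬⁺  : ∀ {n φ k B} → Fresh (mi k) B →
         Concl (pl n) (¬ᶠ φ) B (mi k ∶ φ ∷ [])
  c¬⁻  : ∀ {n φ k B} → Fresh (pl k) B →
         Concl (mi n) (¬ᶠ φ) B (pl k ∶ φ ∷ [])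
  c⇒⁺₁ : ∀ {n φ ψ a b B} → Fresh₂ (mi a) (mi b) B →
         Concl (pl n) (φ ⇒ ψ) B (mi a ∶ φ ∷ mi b ∶ ψ ∷ [])
  c⇒⁺₂ : ∀ {n φ ψ a b B} → Fresh₂ (mi a) (pl b) B →
         Concl (pl n) (φ ⇒ ψ) B (mi a ∶ φ ∷ pl b ∶ ψ ∷ [])
  c⇒⁺₃ : ∀ {n φ ψ a b B} → Fresh₂ (pl a) (pl b) B →
         Concl (pl n) (φ ⇒ ψ) B (pl a ∶ φ ∷ pl b ∶ ψ ∷ [])
  c⇒⁻  : ∀ {n φ ψ a b B} → Fresh₂ (pl a) (mi b) B →
         Concl (mi n) (φ ⇒ ψ) B (pl a ∶ φ ∷ mi b ∶ ψ ∷ [])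
  c≡⁺₁ : ∀ {n φ ψ a b B} → Fresh₂ (pl a) (pl b) B →
         Concl (pl n) (φ ≡ᶠ ψ) B (pl a ∶ φ ∷ pl b ∶ ψ ∷ pl a ≐ pl b ∷ [])
  c≡⁺₂ : ∀ {n φ ψ a b B} → Fresh₂ (mi a) (mi b) B →
         Concl (pl n) (φ ≡ᶠ ψ) B (mi a ∶ φ ∷ mi b ∶ ψ ∷ mi a ≐ mi b ∷ [])
  c≡⁻₁ : ∀ {n φ ψ a b B} → Fresh₂ (pl a) (pl b) B →
         Concl (mi n) (φ ≡ᶠ ψ) B (pl a ∶ φ ∷ pl b ∶ ψ ∷ pl a ≠ᵢ pl b ∷ [])
  c≡⁻₂ : ∀ {n φ ψ a b B} → Fresh₂ (pl a) (mi b) B →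
         Concl (mi n) (φ ≡ᶠ ψ) B (pl a ∶ φ ∷ mi b ∶ ψ ∷ [])
  c≡⁻₃ : ∀ {n φ ψ a b B} → Fresh₂ (mi a) (pl b) B →
         Concl (mi n) (φ ≡ᶠ ψ) B (mi a ∶ φ ∷ pl b ∶ ψ ∷ [])
  c≡⁻₄ : ∀ {n φ ψ a b B} → Fresh₂ (mi a) (mi b) B →
         Concl (mi n) (φ ≡ᶠ ψ) B (mi a ∶ φ ∷ mi b ∶ ψ ∷ mi a ≠ᵢ mi b ∷ [])

data Step : St → St → Set where
  decomp : ∀ {B D w φ C} → (w ∶ φ) ∈ B → (w , φ) ∉ D → Concl w φ B C →
           Step (st B D) (st (C ++ B) ((w , φ) ∷ D))
  r≡¬    : ∀ {B D w v u y φ ψ} →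
           (w ∶ φ) ∈ B → (v ∶ ψ) ∈ B → (w ≐ v) ∈ B →
           (u ∶ ¬ᶠ φ) ∈ B → (y ∶ ¬ᶠ ψ) ∈ B → (u ≐ y) ∉ B →
           Step (st B D) (st (u ≐ y ∷ B) D)
  r≡⇒    : ∀ {B D w v w' v' x z φ ψ χ θ} →
           (w ∶ φ) ∈ B → (v ∶ ψ) ∈ B → (w ≐ v) ∈ B →
           (w' ∶ χ) ∈ B → (v' ∶ θ) ∈ B → (w' ≐ v') ∈ B →
           (x ∶ (φ ⇒ χ)) ∈ B → (z ∶ (ψ ⇒ θ)) ∈ B → (x ≐ z) ∉ B →
           Step (st B D) (st (x ≐ z ∷ B) D)
  r≡≡    : ∀ {B D w v w' v' x z φ ψ χ θ} →
           (w ∶ φ) ∈ B → (v ∶ ψ) ∈ B → (w ≐ v) ∈ B →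
           (w' ∶ χ) ∈ B → (v' ∶ θ) ∈ B → (w' ≐ v') ∈ B →
           (x ∶ (φ ≡ᶠ χ)) ∈ B → (z ∶ (ψ ≡ᶠ θ)) ∈ B → (x ≐ z) ∉ B →
           Step (st B D) (st (x ≐ z ∷ B) D)
  rF     : ∀ {B D w v φ} → (w ∶ φ) ∈ B → (v ∶ φ) ∈ B → (w ≐ v) ∉ B →
           Step (st B D) (st (w ≐ v ∷ B) D)
  rsym   : ∀ {B D w v} → (w ≐ v) ∈ B → (v ≐ w) ∉ B →
           Step (st B D) (st (v ≐ w ∷ B) D)
  rtran  : ∀ {B D w v u} → (w ≐ v) ∈ B → (v ≐ u) ∈ B → (w ≐ u) ∉ B →
           Step (st B D) (st (w ≐ u ∷ B) D)
  cl₁    : ∀ {B D w v} → (w ≐ v) ∈ B → (w ≠ᵢ v) ∈ B →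
           Step (st B D) (st (⊥ᵢ ∷ B) D)
  cl₂    : ∀ {B D n k} → (pl n ≐ mi k) ∈ B →
           Step (st B D) (st (⊥ᵢ ∷ B) D)

rootSt : ℕ → Fm → St
rootSt r φ = st (mi r ∶ φ ∷ []) []

Closed : St → Set
Closed S = ⊥ᵢ ∈ items S

Open : St → Set
Open S = ⊥ᵢ ∉ items S

FullyExpanded : St → Set
FullyExpanded S = Closed S ⊎ (∀ S' → ¬ Step S S')

InLB : List Item → Label → Set
InLB B l = ∃[ ψ ] ((l ∶ ψ) ∈ B)

Sim : List Item → Label → Label → Set
Sim B l t = (l ≐ t) ∈ B

record IsML (B : List Item) (r : ℕ) (ML : List Label) : Set where
  field
    sub    : ∀ {l} → l ∈ ML → InLB B l
    cover  : ∀ {l} → InLB B l → ∃[ m ] (m ∈ ML × SameSign m l × Sim B m l)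
    unique : ∀ {m m'} → m ∈ ML → m' ∈ ML → SameSign m m' → Sim B m m' → m ≡ m'
    root∈  : mi r ∈ ML

data Elem : Set where
  w⁺  : Elem
  ⟨_⟩ : Label → Elem

module Model (B : List Item) (ML : List Label) (r : ℕ) where

  w⁻ : Elem
  w⁻ = ⟨ mi r ⟩

  InD : Elem → Set
  InD w⁺         = ⊤
  InD ⟨ pl n ⟩   = pl n ∈ ML
  InD ⟨ mi n ⟩   = ⊥

  InU : Elem → Set
  InU w⁺      = ⊤
  InU ⟨ l ⟩   = l ∈ ML

  SimE : Elem → Label → Set
  SimE w⁺ t    = ⊥
  SimE ⟨ l ⟩ t = Sim B l t

  NegClosed : Elem → Set
  NegClosed w = ∃[ ψ ] ∃[ u ] ∃[ v ] ∃[ t ]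
    (u ∈ ML × SimE w v × Sim B u t × (v ∶ ψ) ∈ B × (t ∶ ¬ᶠ ψ) ∈ B)

  ImpClosed : Elem → Elem → Set
  ImpClosed w v = ∃[ ψ ] ∃[ θ ] ∃[ u ] ∃[ t ] ∃[ x ] ∃[ y ]
    (u ∈ ML × SimE w t × SimE v x × Sim B u y ×
     (t ∶ ψ) ∈ B × (x ∶ θ) ∈ B × (y ∶ (ψ ⇒ θ)) ∈ B)

  EqvClosed : Elem → Elem → Set
  EqvClosed w v = ∃[ ψ ] ∃[ θ ] ∃[ u ] ∃[ t ] ∃[ x ] ∃[ y ]
    (u ∈ ML × SimE w t × SimE v x × Sim B u y ×
     (t ∶ ψ) ∈ B × (x ∶ θ) ∈ B × (y ∶ (ψ ≡ᶠ θ)) ∈ B)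

  NegC1 : Elem → Elem → Set
  NegC1 w u = Σ Label λ l → u ≡ ⟨ l ⟩ × l ∈ ML ×
    (∃[ ψ ] ∃[ v' ] ∃[ t ] (SimE w v' × Sim B l t × (v' ∶ ψ) ∈ B × (t ∶ ¬ᶠ ψ) ∈ B))

  NegC2 : Elem → Set
  NegC2 w = ¬ NegClosed w × ¬ InD w

  NegR : Elem → Elem → Set
  NegR w u = NegC1 w u
           ⊎ (u ≡ w⁺ × NegC2 w)
           ⊎ (u ≡ w⁻ × (∀ u' → ¬ NegC1 w u') × ¬ NegC2 w)

  ImpC1 : Elem → Elem → Elem → Set
  ImpC1 w v u = Σ Label λ l → u ≡ ⟨ l ⟩ × l ∈ ML ×
    (∃[ ψ ] ∃[ θ ] ∃[ t ] ∃[ x ] ∃[ y ]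
      (SimE w t × SimE v x × Sim B l y ×
       (t ∶ ψ) ∈ B × (x ∶ θ) ∈ B × (y ∶ (ψ ⇒ θ)) ∈ B))

  ImpC2 : Elem → Elem → Set
  ImpC2 w v = v ≡ w⁺
            ⊎ (w ≡ w⁺ × InD v)
            ⊎ (¬ ImpClosed w v × (¬ InD w ⊎ InD v))

  ImpR : Elem → Elem → Elem → Set
  ImpR w v u = ImpC1 w v u
             ⊎ (u ≡ w⁺ × ImpC2 w v)
             ⊎ (u ≡ w⁻ × (∀ u' → ¬ ImpC1 w v u') × ¬ ImpC2 w v)

  EqvC1 : Elem → Elem → Elem → Set
  EqvC1 w v u = Σ Label λ l → u ≡ ⟨ l ⟩ × l ∈ ML ×
    (∃[ ψ ] ∃[ θ ] ∃[ t ] ∃[ x ] ∃[ y ]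
      (SimE w t × SimE v x × Sim B l y ×
       (t ∶ ψ) ∈ B × (x ∶ θ) ∈ B × (y ∶ (ψ ≡ᶠ θ)) ∈ B))

  EqvC2 : Elem → Elem → Set
  EqvC2 w v = w ≡ v × (w ≡ w⁺ ⊎ ¬ EqvClosed w v)

  EqvR : Elem → Elem → Elem → Set
  EqvR w v u = EqvC1 w v u
             ⊎ (u ≡ w⁺ × EqvC2 w v)
             ⊎ (u ≡ w⁻ × (∀ u' → ¬ EqvC1 w v u') × ¬ EqvC2 w v)

  IsSCI : Set
  IsSCI = IsSCIModel InU InD NegR ImpR EqvR

-- On an open, fully expanded branch every equality rule is saturated, so ∼ is a congruence that
-- never relates labels of opposite sign, and every labelled formula has been decomposed (otherwise
-- a decomposition with fresh labels would still apply).  Hence the sign of a label behaves like a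
-- truth value: a label of ¬ψ has the sign opposite to any label of ψ, the sign of a label of ψ → θ
-- is the classical implication of the signs of ψ and θ, and a label of ψ ≡ θ is positive iff the
-- labels of ψ and θ are ∼-related.  Each operation of M_B is given by three clauses.  The first one
-- is single-valued because ∼ is a congruence and ML has one representative per ∼-class, and the
-- sign computations give its semantic condition; the other two clauses are designed to satisfy it.
module Submission where

open import Defs
open import Data.Bool using (Bool; true; false; not; _∨_; T)
open import Data.Bool.Properties using (T-∨)
open import Data.Empty using (⊥; ⊥-elim)
open import Data.List using (List; []; _∷_; _++_)
open import Data.List.Membership.Propositional using (_∈_; _∉_; find; lose)
open import Data.List.Membership.Propositional.Properties using (∈-++⁺ʳ)
open import Data.List.Relation.Binary.Subset.Propositional using (_⊆_)
open import Data.List.Relation.Unary.Any using (Any; here; there; any?)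
open import Data.Nat using (ℕ; _+_; _≤_; _<_; _≟_)
open import Data.Nat.Properties using (≤-refl; ≤-trans; m≤m+n; m≤n+m; <⇒≱; n≤1+n; 1+n≢n)
open import Data.Product using (Σ; _×_; _,_; ∃-syntax; proj₁; proj₂)
import Data.Product.Properties as Product
open import Data.Sum using (_⊎_; inj₁; inj₂)
import Data.Sum as Sum
open import Data.Sum.Function.Propositional using (_⊎-⇔_)
open import Data.Unit using (⊤; tt)
open import Function.Bundles using (_⇔_; mk⇔; Equivalence)
open import Function.Properties.Equivalence using (⇔-setoid) renaming (refl to ⇔-refl)
open import Function.Related.TypeIsomorphisms using (¬-cong-⇔)
open import Level using (0ℓ)
open import Relation.Binary.Definitions using (DecidableEquality)
open import Relation.Binary.PropositionalEquality using (_≡_; refl; sym; trans; cong; cong₂)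
open import Relation.Binary.Construct.Closure.ReflexiveTransitive using (Star; ε; _◅_)
import Relation.Binary.Reasoning.Setoid
open import Relation.Nullary using (¬_; Dec; yes; no; contradiction)
open import Relation.Nullary.Decidable using (map′; ¬?; _×-dec_; _⊎-dec_; decidable-stable)

infix 4 _≟ᶠ_ _≟ˡ_ _≟ˡᶠ_ _≟ᵉ_

_≟ᶠ_ : DecidableEquality Fm
atom m ≟ᶠ atom n = map′ (cong atom) (λ { refl → refl }) (m ≟ n)
¬ᶠ φ ≟ᶠ ¬ᶠ ψ     = map′ (cong ¬ᶠ_) (λ { refl → refl }) (φ ≟ᶠ ψ)
φ ⇒ χ ≟ᶠ ψ ⇒ θ   =
  map′ (λ (p , q) → cong₂ _⇒_ p q) (λ { refl → refl , refl }) (φ ≟ᶠ ψ ×-dec χ ≟ᶠ θ)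
φ ≡ᶠ χ ≟ᶠ ψ ≡ᶠ θ =
  map′ (λ (p , q) → cong₂ _≡ᶠ_ p q) (λ { refl → refl , refl }) (φ ≟ᶠ ψ ×-dec χ ≟ᶠ θ)
atom _ ≟ᶠ ¬ᶠ _   = no λ ()
atom _ ≟ᶠ _ ⇒ _  = no λ ()
atom _ ≟ᶠ _ ≡ᶠ _ = no λ ()
¬ᶠ _ ≟ᶠ atom _   = no λ ()
¬ᶠ _ ≟ᶠ _ ⇒ _    = no λ ()
¬ᶠ _ ≟ᶠ _ ≡ᶠ _   = no λ ()
_ ⇒ _ ≟ᶠ atom _  = no λ ()
_ ⇒ _ ≟ᶠ ¬ᶠ _    = no λ ()
_ ⇒ _ ≟ᶠ _ ≡ᶠ _  = no λ ()
_ ≡ᶠ _ ≟ᶠ atom _ = no λ ()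
_ ≡ᶠ _ ≟ᶠ ¬ᶠ _   = no λ ()
_ ≡ᶠ _ ≟ᶠ _ ⇒ _  = no λ ()

_≟ˡ_ : DecidableEquality Label
pl m ≟ˡ pl n = map′ (cong pl) (λ { refl → refl }) (m ≟ n)
mi m ≟ˡ mi n = map′ (cong mi) (λ { refl → refl }) (m ≟ n)
pl _ ≟ˡ mi _ = no λ ()
mi _ ≟ˡ pl _ = no λ ()

_≟ˡᶠ_ : DecidableEquality (Label × Fm)
_≟ˡᶠ_ = Product.≡-dec _≟ˡ_ _≟ᶠ_

_≟ᵉ_ : DecidableEquality Elem
w⁺ ≟ᵉ w⁺        = yes refl
⟨ l ⟩ ≟ᵉ ⟨ l' ⟩ = map′ (cong ⟨_⟩) (λ { refl → refl }) (l ≟ˡ l')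
w⁺ ≟ᵉ ⟨ _ ⟩     = no λ ()
⟨ _ ⟩ ≟ᵉ w⁺     = no λ ()

≐-≟ : ∀ l t i → Dec ((l ≐ t) ≡ i)
≐-≟ l t (a ≐ b)  =
  map′ (λ (p , q) → cong₂ _≐_ p q) (λ { refl → refl , refl }) (l ≟ˡ a ×-dec t ≟ˡ b)
≐-≟ l t (_ ∶ _)  = no λ ()
≐-≟ l t (_ ≠ᵢ _) = no λ ()
≐-≟ l t ⊥ᵢ       = no λ ()

≐-∈? : ∀ l t B → Dec ((l ≐ t) ∈ B)
≐-∈? l t = any? (≐-≟ l t)

∃-∈? : {A : Set} {P : A → Set} → (∀ x → Dec (P x)) → (xs : List A) →
       Dec (∃[ x ] (x ∈ xs × P x))
∃-∈? P? xs = map′ find (λ (_ , x∈ , px) → lose x∈ px) (any? P? xs)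

Labelled : (Label → Fm → Set) → Item → Set
Labelled P (v ∶ ψ) = P v ψ
Labelled P _       = ⊥

labelled? : {P : Label → Fm → Set} → (∀ v ψ → Dec (P v ψ)) → (B : List Item) →
            Dec (∃[ v ] ∃[ ψ ] ((v ∶ ψ) ∈ B × P v ψ))
labelled? {P} P? B = map′ (λ { (v ∶ ψ , i∈ , p) → v , ψ , i∈ , p })
                          (λ (v , ψ , i∈ , p) → v ∶ ψ , i∈ , p)
                          (∃-∈? labelledItem? B)
  where
  labelledItem? : ∀ i → Dec (Labelled P i)
  labelledItem? (v ∶ ψ)  = P? v ψ
  labelledItem? (_ ≐ _)  = no λ ()
  labelledItem? (_ ≠ᵢ _) = no λ ()
  labelledItem? ⊥ᵢ       = no λ ()

index : Label → ℕ
index (pl n) = n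
index (mi n) = n

weight : Item → ℕ
weight (v ∶ _)  = index v
weight (v ≐ u)  = index v + index u
weight (v ≠ᵢ u) = index v + index u
weight ⊥ᵢ       = 0

bound : List Item → ℕ
bound []      = 0
bound (i ∷ B) = weight i + bound B

mentioned-≤-weight : ∀ {l} i → Mentions l i → index l ≤ weight i
mentioned-≤-weight (v ∶ _)  refl        = ≤-refl
mentioned-≤-weight (v ≐ u)  (inj₁ refl) = m≤m+n (index v) (index u)
mentioned-≤-weight (v ≐ u)  (inj₂ refl) = m≤n+m (index u) (index v)
mentioned-≤-weight (v ≠ᵢ u) (inj₁ refl) = m≤m+n (index v) (index u)
mentioned-≤-weight (v ≠ᵢ u) (inj₂ refl) = m≤n+m (index u) (index v)

mentioned-≤-bound : ∀ {l} B → Any (Mentions l) B → index l ≤ bound B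
mentioned-≤-bound (i ∷ B) (here m)  =
  ≤-trans (mentioned-≤-weight i m) (m≤m+n (weight i) (bound B))
mentioned-≤-bound (i ∷ B) (there m) =
  ≤-trans (mentioned-≤-bound B m) (m≤n+m (bound B) (weight i))

fresh : ∀ {l} B → bound B < index l → Fresh l B
fresh B bound<l l∈B = <⇒≱ bound<l (mentioned-≤-bound B l∈B)

truth : Label → Bool
truth (pl _) = true
truth (mi _) = false

sameSign-truth : ∀ {l t} → SameSign l t → truth l ≡ truth t
sameSign-truth {pl _} {pl _} _ = refl
sameSign-truth {mi _} {mi _} _ = refl

-- What a decomposition of  w : φ  leaves on the branch, whichever alternative was chosen.
Realised : List Item → Label → Fm → Set
Realised B w (atom _) = ⊤
Realised B w (¬ᶠ ψ)   = ∃[ v ] ((v ∶ ψ) ∈ B × truth w ≡ not (truth v))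
Realised B w (ψ ⇒ θ)  =
  ∃[ v ] ∃[ u ] ((v ∶ ψ) ∈ B × (u ∶ θ) ∈ B × truth w ≡ not (truth v) ∨ truth u)
Realised B (pl _) (ψ ≡ᶠ θ) = ∃[ v ] ∃[ u ] ((v ∶ ψ) ∈ B × (u ∶ θ) ∈ B × (v ≐ u) ∈ B)
Realised B (mi _) (ψ ≡ᶠ θ) =
  ∃[ v ] ∃[ u ] ((v ∶ ψ) ∈ B × (u ∶ θ) ∈ B × ((v ≠ᵢ u) ∈ B ⊎ ¬ SameSign v u))

realised-mono : ∀ {B B'} → B ⊆ B' → ∀ w φ → Realised B w φ → Realised B' w φ
realised-mono B⊆B' w (atom _) _ = tt
realised-mono B⊆B' w (¬ᶠ _) (v , v∶ψ , e) = v , B⊆B' v∶ψ , e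
realised-mono B⊆B' w (_ ⇒ _) (v , u , v∶ψ , u∶θ , e) = v , u , B⊆B' v∶ψ , B⊆B' u∶θ , e
realised-mono B⊆B' (pl _) (_ ≡ᶠ _) (v , u , v∶ψ , u∶θ , v≐u) =
  v , u , B⊆B' v∶ψ , B⊆B' u∶θ , B⊆B' v≐u
realised-mono B⊆B' (mi _) (_ ≡ᶠ _) (v , u , v∶ψ , u∶θ , v≉u) =
  v , u , B⊆B' v∶ψ , B⊆B' u∶θ , Sum.map₁ B⊆B' v≉u

conclusion-realised : ∀ {w φ B C} → Concl w φ B C → Realised (C ++ B) w φ
conclusion-realised (c¬⁺ _)  = _ , here refl , refl
conclusion-realised (c¬⁻ _)  = _ , here refl , refl
conclusion-realised (c⇒⁺₁ _) = _ , _ , here refl , there (here refl) , refl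
conclusion-realised (c⇒⁺₂ _) = _ , _ , here refl , there (here refl) , refl
conclusion-realised (c⇒⁺₃ _) = _ , _ , here refl , there (here refl) , refl
conclusion-realised (c⇒⁻ _)  = _ , _ , here refl , there (here refl) , refl
conclusion-realised (c≡⁺₁ _) = _ , _ , here refl , there (here refl) , there (there (here refl))
conclusion-realised (c≡⁺₂ _) = _ , _ , here refl , there (here refl) , there (there (here refl))
conclusion-realised (c≡⁻₁ _) =
  _ , _ , here refl , there (here refl) , inj₁ (there (there (here refl)))
conclusion-realised (c≡⁻₂ _) = _ , _ , here refl , there (here refl) , inj₂ λ ()
conclusion-realised (c≡⁻₃ _) = _ , _ , here refl , there (here refl) , inj₂ λ ()
conclusion-realised (c≡⁻₄ _) =
  _ , _ , here refl , there (here refl) , inj₁ (there (there (here refl)))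

DoneRealised : St → Set
DoneRealised S = ∀ {w φ} → (w , φ) ∈ done S → Realised (items S) w φ

step-preserves-DoneRealised : ∀ {S S'} → Step S S' → DoneRealised S → DoneRealised S'
step-preserves-DoneRealised (decomp _ _ c) _ (here refl) = conclusion-realised c
step-preserves-DoneRealised (decomp {C = C} _ _ _) R {w} {φ} (there d) =
  realised-mono (∈-++⁺ʳ C) w φ (R d)
step-preserves-DoneRealised (r≡¬ _ _ _ _ _ _) R {w} {φ} d       = realised-mono there w φ (R d)
step-preserves-DoneRealised (r≡⇒ _ _ _ _ _ _ _ _ _) R {w} {φ} d = realised-mono there w φ (R d)
step-preserves-DoneRealised (r≡≡ _ _ _ _ _ _ _ _ _) R {w} {φ} d = realised-mono there w φ (R d)
step-preserves-DoneRealised (rF _ _ _) R {w} {φ} d              = realised-mono there w φ (R d)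
step-preserves-DoneRealised (rsym _ _) R {w} {φ} d              = realised-mono there w φ (R d)
step-preserves-DoneRealised (rtran _ _ _) R {w} {φ} d           = realised-mono there w φ (R d)
step-preserves-DoneRealised (cl₁ _ _) R {w} {φ} d               = realised-mono there w φ (R d)
step-preserves-DoneRealised (cl₂ _) R {w} {φ} d                 = realised-mono there w φ (R d)

star-preserves-DoneRealised : ∀ {S S'} → Star Step S S' → DoneRealised S → DoneRealised S'
star-preserves-DoneRealised ε        R = R
star-preserves-DoneRealised (s ◅ ss) R =
  star-preserves-DoneRealised ss (step-preserves-DoneRealised s R)

Congruent₂ : List Item → (Fm → Fm → Fm) → Set
Congruent₂ B _∙_ = ∀ {w v w' v' x z φ ψ χ θ} →
  (w ∶ φ) ∈ B → (v ∶ ψ) ∈ B → (w ≐ v) ∈ B →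
  (w' ∶ χ) ∈ B → (v' ∶ θ) ∈ B → (w' ≐ v') ∈ B →
  (x ∶ (φ ∙ χ)) ∈ B → (z ∶ (ψ ∙ θ)) ∈ B → (x ≐ z) ∈ B

record Saturated (B : List Item) : Set where
  field
    ≐-sym      : ∀ {w v} → (w ≐ v) ∈ B → (v ≐ w) ∈ B
    ≐-trans    : ∀ {w v u} → (w ≐ v) ∈ B → (v ≐ u) ∈ B → (w ≐ u) ∈ B
    ∶-≐        : ∀ {w v φ} → (w ∶ φ) ∈ B → (v ∶ φ) ∈ B → (w ≐ v) ∈ B
    ≐-≠-clash  : ∀ {w v} → (w ≐ v) ∈ B → (w ≠ᵢ v) ∉ B
    sign-clash : ∀ {n k} → (pl n ≐ mi k) ∉ B
    ¬-cong     : ∀ {w v u y φ ψ} → (w ∶ φ) ∈ B → (v ∶ ψ) ∈ B → (w ≐ v) ∈ B →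
                 (u ∶ ¬ᶠ φ) ∈ B → (y ∶ ¬ᶠ ψ) ∈ B → (u ≐ y) ∈ B
    ⇒-cong     : Congruent₂ B _⇒_
    ≡-cong     : Congruent₂ B _≡ᶠ_
    realised   : ∀ {w φ} → (w ∶ φ) ∈ B → Realised B w φ

module _ {S : St} (doneRealised : DoneRealised S) (stuck : ∀ S' → ¬ Step S S') where
  private
    B = items S

    by-saturation : ∀ {l t} → ((l ≐ t) ∉ B → Step S (st (l ≐ t ∷ B) (done S))) → (l ≐ t) ∈ B
    by-saturation {l} {t} rule = decidable-stable (≐-∈? l t B) (λ ∉B → stuck _ (rule ∉B))

    decomposed : ∀ {w φ C} → (w ∶ φ) ∈ B → Concl w φ B C → Realised B w φ
    decomposed {w} {φ} w∶φ c with any? ((w , φ) ≟ˡᶠ_) (done S)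
    ... | yes isDone = doneRealised isDone
    ... | no notDone = contradiction (decomp w∶φ notDone c) (stuck _)

    -- Any applicable alternative refutes stuck; opposite signs spare a distinctness proof.
    realised : ∀ {w φ} → (w ∶ φ) ∈ B → Realised B w φ
    realised {φ = atom _}      _ = tt
    realised {pl _} {¬ᶠ _}   w∶φ = decomposed w∶φ (c¬⁺ (fresh B ≤-refl))
    realised {mi _} {¬ᶠ _}   w∶φ = decomposed w∶φ (c¬⁻ (fresh B ≤-refl))
    realised {pl _} {_ ⇒ _}  w∶φ = decomposed w∶φ (c⇒⁺₂ (fresh B ≤-refl , fresh B ≤-refl , λ ()))
    realised {mi _} {_ ⇒ _}  w∶φ = decomposed w∶φ (c⇒⁻ (fresh B ≤-refl , fresh B ≤-refl , λ ()))
    realised {mi _} {_ ≡ᶠ _} w∶φ = decomposed w∶φ (c≡⁻₂ (fresh B ≤-refl , fresh B ≤-refl , λ ()))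
    realised {pl _} {_ ≡ᶠ _} w∶φ =
      decomposed w∶φ (c≡⁺₁ (fresh B ≤-refl , fresh B (n≤1+n _) , λ e → 1+n≢n (sym (cong index e))))

  stuck-saturated : Saturated B
  stuck-saturated = record
    { ≐-sym      = λ w≐v → by-saturation (rsym w≐v)
    ; ≐-trans    = λ w≐v v≐u → by-saturation (rtran w≐v v≐u)
    ; ∶-≐        = λ w∶φ v∶φ → by-saturation (rF w∶φ v∶φ)
    ; ≐-≠-clash  = λ w≐v w≠v → stuck _ (cl₁ w≐v w≠v)
    ; sign-clash = λ n≐k → stuck _ (cl₂ n≐k)
    ; ¬-cong     = λ a b c d e → by-saturation (r≡¬ a b c d e)
    ; ⇒-cong     = λ a b c d e f g h → by-saturation (r≡⇒ a b c d e f g h)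
    ; ≡-cong     = λ a b c d e f g h → by-saturation (r≡≡ a b c d e f g h)
    ; realised   = realised
    }

module SaturatedTruth {B : List Item} (sat : Saturated B) where
  open Saturated sat

  ≐-refl : ∀ {l ψ} → (l ∶ ψ) ∈ B → (l ≐ l) ∈ B
  ≐-refl l∶ψ = ∶-≐ l∶ψ l∶ψ

  ≐-sameSign : ∀ {l t} → (l ≐ t) ∈ B → SameSign l t
  ≐-sameSign {pl _} {pl _} _   = tt
  ≐-sameSign {pl _} {mi _} l≐t = sign-clash l≐t
  ≐-sameSign {mi _} {pl _} l≐t = sign-clash (≐-sym l≐t)
  ≐-sameSign {mi _} {mi _} _   = tt

  ≐-truth : ∀ {l t} → (l ≐ t) ∈ B → truth l ≡ truth t
  ≐-truth l≐t = sameSign-truth (≐-sameSign l≐t)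

  ¬-truth : ∀ {v t ψ} → (v ∶ ψ) ∈ B → (t ∶ ¬ᶠ ψ) ∈ B → truth t ≡ not (truth v)
  ¬-truth v∶ψ t∶¬ψ =
    let v' , v'∶ψ , e = realised t∶¬ψ in
    trans e (cong not (≐-truth (∶-≐ v'∶ψ v∶ψ)))

  ⇒-truth : ∀ {t x y ψ θ} → (t ∶ ψ) ∈ B → (x ∶ θ) ∈ B → (y ∶ (ψ ⇒ θ)) ∈ B →
            truth y ≡ not (truth t) ∨ truth x
  ⇒-truth t∶ψ x∶θ y∶ψ⇒θ =
    let t' , x' , t'∶ψ , x'∶θ , e = realised y∶ψ⇒θ in
    trans e (cong₂ (λ p q → not p ∨ q) (≐-truth (∶-≐ t'∶ψ t∶ψ)) (≐-truth (∶-≐ x'∶θ x∶θ)))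

  ≡-truth : ∀ {t x y ψ θ} → (t ∶ ψ) ∈ B → (x ∶ θ) ∈ B → (y ∶ (ψ ≡ᶠ θ)) ∈ B →
            T (truth y) ⇔ (t ≐ x) ∈ B
  ≡-truth {y = pl _} t∶ψ x∶θ y∶ψ≡θ =
    let v , u , v∶ψ , u∶θ , v≐u = realised y∶ψ≡θ in
    mk⇔ (λ _ → ≐-trans (∶-≐ t∶ψ v∶ψ) (≐-trans v≐u (∶-≐ u∶θ x∶θ))) (λ _ → tt)
  ≡-truth {y = mi _} t∶ψ x∶θ y∶ψ≡θ =
    let v , u , v∶ψ , u∶θ , v≉u = realised y∶ψ≡θ in
    mk⇔ (λ ()) λ t≐x →
      let v≐u = ≐-trans (∶-≐ v∶ψ t∶ψ) (≐-trans t≐x (∶-≐ x∶θ u∶θ)) in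
      Sum.[ ≐-≠-clash v≐u , contradiction (≐-sameSign v≐u) ] v≉u

T-not : ∀ {b} → T (not b) ⇔ (¬ T b)
T-not {true}  = mk⇔ (λ ()) (λ ¬⊤ → ¬⊤ tt)
T-not {false} = mk⇔ (λ _ ()) (λ _ → tt)

module SCIModel (B : List Item) (ML : List Label) (r : ℕ)
                (sat : Saturated B) (isML : IsML B r ML) where
  open Model B ML r
  open Saturated sat
  open SaturatedTruth sat
  open IsML isML
  open Equivalence using (to; from)
  module ⇔-Reasoning = Relation.Binary.Reasoning.Setoid (⇔-setoid 0ℓ)

  rep-≐⇒≡ : ∀ {l l'} → l ∈ ML → l' ∈ ML → (l ≐ l') ∈ B → ⟨ l ⟩ ≡ ⟨ l' ⟩
  rep-≐⇒≡ l∈ l'∈ l≐l' = cong ⟨_⟩ (unique l∈ l'∈ (≐-sameSign l≐l') l≐l')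

  rep-≐⇔≡ : ∀ {l l'} → l ∈ ML → l' ∈ ML → (l ≐ l') ∈ B ⇔ (⟨ l ⟩ ≡ ⟨ l' ⟩)
  rep-≐⇔≡ l∈ l'∈ = mk⇔ (rep-≐⇒≡ l∈ l'∈) (λ { refl → ≐-refl (proj₂ (sub l∈)) })

  rep-∼⇒≡ : ∀ {l l' y y'} → l ∈ ML → l' ∈ ML → Sim B l y → Sim B l' y' → (y ≐ y') ∈ B →
            ⟨ l ⟩ ≡ ⟨ l' ⟩
  rep-∼⇒≡ l∈ l'∈ l∼y l'∼y' y≐y' = rep-≐⇒≡ l∈ l'∈ (≐-trans l∼y (≐-trans y≐y' (≐-sym l'∼y')))

  designated-rep : ∀ {l} → l ∈ ML → InD ⟨ l ⟩ ⇔ T (truth l)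
  designated-rep {pl _} l∈ = mk⇔ (λ _ → tt) (λ _ → l∈)
  designated-rep {mi _} _  = mk⇔ (λ ()) (λ ())

  designated? : ∀ a → Dec (InD a)
  designated? w⁺       = yes tt
  designated? ⟨ pl n ⟩ = any? (pl n ≟ˡ_) ML
  designated? ⟨ mi _ ⟩ = no λ ()

  simE? : ∀ a t → Dec (SimE a t)
  simE? w⁺    _ = no λ ()
  simE? ⟨ l ⟩ t = ≐-∈? l t B

  simE-≐ : ∀ {a t t'} → SimE a t → SimE a t' → (t ≐ t') ∈ B
  simE-≐ {⟨ _ ⟩} a∼t a∼t' = ≐-trans (≐-sym a∼t) a∼t'

  Cases : (Elem → Set) → Set → Elem → Set
  Cases C₁ C₂ u = C₁ u ⊎ (u ≡ w⁺ × C₂) ⊎ (u ≡ w⁻ × (∀ u' → ¬ C₁ u') × ¬ C₂)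

  module _ {C₁ : Elem → Set} {C₂ : Set} where

    cases-total : (∀ {u} → C₁ u → InU u) → Dec (Σ Elem C₁) → Dec C₂ →
                  ∃[ u ] (InU u × Cases C₁ C₂ u)
    cases-total C₁⊆U (yes (u , c₁)) _        = u , C₁⊆U c₁ , inj₁ c₁
    cases-total _    (no ¬c₁)       (yes c₂) = w⁺ , tt , inj₂ (inj₁ (refl , c₂))
    cases-total _    (no ¬c₁)       (no ¬c₂) =
      w⁻ , root∈ , inj₂ (inj₂ (refl , (λ u c₁ → ¬c₁ (u , c₁)) , ¬c₂))

    cases-functional : (∀ {u u'} → C₁ u → C₁ u' → u ≡ u') → (∀ {u} → C₁ u → ¬ C₂) →
                       ∀ {u u'} → Cases C₁ C₂ u → Cases C₁ C₂ u' → u ≡ u'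
    cases-functional C₁-func _ (inj₁ c₁) (inj₁ c₁') = C₁-func c₁ c₁'
    cases-functional _ excl (inj₁ c₁) (inj₂ (inj₁ (_ , c₂)))      = ⊥-elim (excl c₁ c₂)
    cases-functional _ _    (inj₁ c₁) (inj₂ (inj₂ (_ , ¬c₁ , _))) = ⊥-elim (¬c₁ _ c₁)
    cases-functional _ excl (inj₂ (inj₁ (_ , c₂))) (inj₁ c₁)      = ⊥-elim (excl c₁ c₂)
    cases-functional _ _    (inj₂ (inj₂ (_ , ¬c₁ , _))) (inj₁ c₁) = ⊥-elim (¬c₁ _ c₁)
    cases-functional _ _ (inj₂ (inj₁ (refl , _))) (inj₂ (inj₁ (refl , _))) = refl
    cases-functional _ _ (inj₂ (inj₂ (refl , _))) (inj₂ (inj₂ (refl , _))) = refl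
    cases-functional _ _ (inj₂ (inj₁ (_ , c₂))) (inj₂ (inj₂ (_ , _ , ¬c₂))) = ⊥-elim (¬c₂ c₂)
    cases-functional _ _ (inj₂ (inj₂ (_ , _ , ¬c₂))) (inj₂ (inj₁ (_ , c₂))) = ⊥-elim (¬c₂ c₂)

    cases-designated : {P : Set} → (∀ {u} → C₁ u → InD u ⇔ P) → (C₂ → P) →
                       (¬ Σ Elem C₁ → P → C₂) → ∀ {u} → Cases C₁ C₂ u → InD u ⇔ P
    cases-designated C₁-sem _ _ (inj₁ c₁) = C₁-sem c₁
    cases-designated _ C₂⇒P _ (inj₂ (inj₁ (refl , c₂))) = mk⇔ (λ _ → C₂⇒P c₂) (λ _ → tt)
    cases-designated _ _ P⇒C₂ (inj₂ (inj₂ (refl , ¬c₁ , ¬c₂))) =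
      mk⇔ (λ ()) (λ p → ¬c₂ (P⇒C₂ (λ (u , c₁) → ¬c₁ u c₁) p))

  negC1-closed : ∀ {a u} → NegC1 a u → NegClosed a
  negC1-closed (l , refl , l∈ , ψ , v , t , a∼v , l∼t , v∶ψ , t∶¬ψ) =
    ψ , l , v , t , l∈ , a∼v , l∼t , v∶ψ , t∶¬ψ

  negClosed-C1 : ∀ {a} → NegClosed a → Σ Elem (NegC1 a)
  negClosed-C1 (ψ , u , v , t , u∈ , a∼v , u∼t , v∶ψ , t∶¬ψ) =
    ⟨ u ⟩ , u , refl , u∈ , ψ , v , t , a∼v , u∼t , v∶ψ , t∶¬ψ

  negClosed? : ∀ a → Dec (NegClosed a)
  negClosed? a = map′
    (λ { (u , u∈ , v , ψ , v∶ψ , a∼v , t , _ , t∶¬ψ , u∼t , refl) →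
         ψ , u , v , t , u∈ , a∼v , u∼t , v∶ψ , t∶¬ψ })
    (λ (ψ , u , v , t , u∈ , a∼v , u∼t , v∶ψ , t∶¬ψ) →
       u , u∈ , v , ψ , v∶ψ , a∼v , t , ¬ᶠ ψ , t∶¬ψ , u∼t , refl)
    (∃-∈? (λ u → labelled? (λ v ψ → simE? a v ×-dec
       labelled? (λ t χ → ≐-∈? u t B ×-dec χ ≟ᶠ ¬ᶠ ψ) B) B) ML)

  negC1-functional : ∀ {a u u'} → NegC1 a u → NegC1 a u' → u ≡ u'
  negC1-functional (l , refl , l∈ , _ , _ , _ , a∼v , l∼t , v∶ψ , t∶¬ψ)
                   (l' , refl , l'∈ , _ , _ , _ , a∼v' , l'∼t' , v'∶ψ' , t'∶¬ψ') =
    rep-∼⇒≡ l∈ l'∈ l∼t l'∼t' (¬-cong v∶ψ v'∶ψ' (simE-≐ a∼v a∼v') t∶¬ψ t'∶¬ψ')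

  negC1-designated : ∀ {a u} → InU a → NegC1 a u → InD u ⇔ (¬ InD a)
  negC1-designated {⟨ x ⟩} x∈ (l , refl , l∈ , _ , _ , _ , x∼v , l∼t , v∶ψ , t∶¬ψ) = begin
    (InD ⟨ l ⟩)       ≈⟨ designated-rep l∈ ⟩
    T (truth l)       ≡⟨ cong T l-truth ⟩
    T (not (truth x)) ≈⟨ T-not ⟩
    ¬ T (truth x)     ≈⟨ ¬-cong-⇔ (designated-rep x∈) ⟨
    (¬ InD ⟨ x ⟩)     ∎
    where
    open ⇔-Reasoning
    l-truth : truth l ≡ not (truth x)
    l-truth = trans (≐-truth l∼t) (trans (¬-truth v∶ψ t∶¬ψ) (cong not (sym (≐-truth x∼v))))

  neg-total : ∀ a → ∃[ u ] (InU u × NegR a u)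
  neg-total a = cases-total (λ { (_ , refl , l∈ , _) → l∈ })
    (map′ negClosed-C1 (λ (_ , c₁) → negC1-closed c₁) (negClosed? a))
    (¬? (negClosed? a) ×-dec ¬? (designated? a))

  neg-functional : ∀ {a u u'} → NegR a u → NegR a u' → u ≡ u'
  neg-functional =
    cases-functional negC1-functional (λ c₁ (¬closed , _) → ¬closed (negC1-closed c₁))

  neg-designated : ∀ {a u} → InU a → NegR a u → InD u ⇔ (¬ InD a)
  neg-designated a∈ = cases-designated (negC1-designated a∈) proj₂
    (λ ¬c₁ ¬Da → (λ nc → ¬c₁ (negClosed-C1 nc)) , ¬Da)

  -- ImpC1, ImpClosed (resp. EqvC1, EqvClosed) are these at _⇒_ (resp. _≡ᶠ_), definitionally.
  BinC1 : (Fm → Fm → Fm) → Elem → Elem → Elem → Set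
  BinC1 _∙_ w v u = Σ Label λ l → u ≡ ⟨ l ⟩ × l ∈ ML ×
    (∃[ ψ ] ∃[ θ ] ∃[ t ] ∃[ x ] ∃[ y ]
      (SimE w t × SimE v x × Sim B l y × (t ∶ ψ) ∈ B × (x ∶ θ) ∈ B × (y ∶ (ψ ∙ θ)) ∈ B))

  BinClosed : (Fm → Fm → Fm) → Elem → Elem → Set
  BinClosed _∙_ w v = ∃[ ψ ] ∃[ θ ] ∃[ u ] ∃[ t ] ∃[ x ] ∃[ y ]
    (u ∈ ML × SimE w t × SimE v x × Sim B u y × (t ∶ ψ) ∈ B × (x ∶ θ) ∈ B × (y ∶ (ψ ∙ θ)) ∈ B)

  module _ (_∙_ : Fm → Fm → Fm) where

    binC1-closed : ∀ {a b u} → BinC1 _∙_ a b u → BinClosed _∙_ a b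
    binC1-closed (l , refl , l∈ , ψ , θ , t , x , y , a∼t , b∼x , l∼y , t∶ψ , x∶θ , y∶ψ∙θ) =
      ψ , θ , l , t , x , y , l∈ , a∼t , b∼x , l∼y , t∶ψ , x∶θ , y∶ψ∙θ

    binClosed-C1 : ∀ {a b} → BinClosed _∙_ a b → Σ Elem (BinC1 _∙_ a b)
    binClosed-C1 (ψ , θ , u , t , x , y , u∈ , a∼t , b∼x , u∼y , t∶ψ , x∶θ , y∶ψ∙θ) =
      ⟨ u ⟩ , u , refl , u∈ , ψ , θ , t , x , y , a∼t , b∼x , u∼y , t∶ψ , x∶θ , y∶ψ∙θ

    binClosed? : ∀ a b → Dec (BinClosed _∙_ a b)
    binClosed? a b = map′
      (λ { (u , u∈ , t , ψ , t∶ψ , a∼t , x , θ , x∶θ , b∼x , y , _ , y∶ψ∙θ , u∼y , refl) →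
           ψ , θ , u , t , x , y , u∈ , a∼t , b∼x , u∼y , t∶ψ , x∶θ , y∶ψ∙θ })
      (λ (ψ , θ , u , t , x , y , u∈ , a∼t , b∼x , u∼y , t∶ψ , x∶θ , y∶ψ∙θ) →
         u , u∈ , t , ψ , t∶ψ , a∼t , x , θ , x∶θ , b∼x , y , ψ ∙ θ , y∶ψ∙θ , u∼y , refl)
      (∃-∈? (λ u → labelled? (λ t ψ → simE? a t ×-dec labelled? (λ x θ → simE? b x ×-dec
         labelled? (λ y χ → ≐-∈? u y B ×-dec χ ≟ᶠ ψ ∙ θ) B) B) B) ML)

    ∃binC1? : ∀ a b → Dec (Σ Elem (BinC1 _∙_ a b))
    ∃binC1? a b = map′ binClosed-C1 (λ (_ , c₁) → binC1-closed c₁) (binClosed? a b)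

    binC1-functional : Congruent₂ B _∙_ →
                       ∀ {a b u u'} → BinC1 _∙_ a b u → BinC1 _∙_ a b u' → u ≡ u'
    binC1-functional ∙-cong
      (l , refl , l∈ , _ , _ , _ , _ , _ , a∼t , b∼x , l∼y , t∶ψ , x∶θ , y∶ψ∙θ)
      (l' , refl , l'∈ , _ , _ , _ , _ , _ , a∼t' , b∼x' , l'∼y' , t'∶ψ' , x'∶θ' , y'∶ψ'∙θ') =
      rep-∼⇒≡ l∈ l'∈ l∼y l'∼y'
        (∙-cong t∶ψ t'∶ψ' (simE-≐ a∼t a∼t') x∶θ x'∶θ' (simE-≐ b∼x b∼x') y∶ψ∙θ y'∶ψ'∙θ')

  impC1-designated : ∀ {a b u} → InU a → InU b → ImpC1 a b u → InD u ⇔ (¬ InD a ⊎ InD b)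
  impC1-designated {⟨ x ⟩} {⟨ z ⟩} x∈ z∈
    (l , refl , l∈ , _ , _ , _ , _ , _ , x∼t , z∼x' , l∼y , t∶ψ , x'∶θ , y∶ψ⇒θ) = begin
    (InD ⟨ l ⟩)                       ≈⟨ designated-rep l∈ ⟩
    T (truth l)                       ≡⟨ cong T l-truth ⟩
    T (not (truth x) ∨ truth z)       ≈⟨ T-∨ ⟩
    (T (not (truth x)) ⊎ T (truth z)) ≈⟨ T-not ⊎-⇔ ⇔-refl ⟩
    (¬ T (truth x) ⊎ T (truth z))     ≈⟨ ¬-cong-⇔ (designated-rep x∈) ⊎-⇔ designated-rep z∈ ⟨
    (¬ InD ⟨ x ⟩ ⊎ InD ⟨ z ⟩)         ∎
    where
    open ⇔-Reasoning
    l-truth : truth l ≡ not (truth x) ∨ truth z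
    l-truth = trans (≐-truth l∼y) (trans (⇒-truth t∶ψ x'∶θ y∶ψ⇒θ)
                (sym (cong₂ (λ p q → not p ∨ q) (≐-truth x∼t) (≐-truth z∼x'))))

  imp-total : ∀ a b → ∃[ u ] (InU u × ImpR a b u)
  imp-total a b = cases-total (λ { (_ , refl , l∈ , _) → l∈ }) (∃binC1? _⇒_ a b)
    (b ≟ᵉ w⁺ ⊎-dec (a ≟ᵉ w⁺ ×-dec designated? b) ⊎-dec
     (¬? (binClosed? _⇒_ a b) ×-dec (¬? (designated? a) ⊎-dec designated? b)))

  impC1-excludes-C2 : ∀ {a b u} → ImpC1 a b u → ¬ ImpC2 a b
  impC1-excludes-C2 {⟨ _ ⟩} {⟨ _ ⟩} c₁ (inj₂ (inj₂ (¬closed , _))) =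
    ¬closed (binC1-closed _⇒_ c₁)

  imp-functional : ∀ {a b u u'} → ImpR a b u → ImpR a b u' → u ≡ u'
  imp-functional = cases-functional (binC1-functional _⇒_ ⇒-cong) impC1-excludes-C2

  imp-designated : ∀ {a b u} → InU a → InU b → ImpR a b u → InD u ⇔ (¬ InD a ⊎ InD b)
  imp-designated {a} {b} a∈ b∈ = cases-designated (impC1-designated a∈ b∈) C₂⇒P
    (λ ¬c₁ p → inj₂ (inj₂ ((λ ic → ¬c₁ (binClosed-C1 _⇒_ ic)) , p)))
    where
    C₂⇒P : ImpC2 a b → ¬ InD a ⊎ InD b
    C₂⇒P (inj₁ refl)            = inj₂ tt
    C₂⇒P (inj₂ (inj₁ (_ , Db))) = inj₂ Db
    C₂⇒P (inj₂ (inj₂ (_ , p)))  = p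

  eqvC1-designated : ∀ {a b u} → InU a → InU b → EqvC1 a b u → InD u ⇔ (a ≡ b)
  eqvC1-designated {⟨ x ⟩} {⟨ z ⟩} x∈ z∈
    (l , refl , l∈ , _ , _ , t , x' , y , x∼t , z∼x' , l∼y , t∶ψ , x'∶θ , y∶ψ≡θ) = begin
    (InD ⟨ l ⟩)     ≈⟨ designated-rep l∈ ⟩
    T (truth l)     ≡⟨ cong T (≐-truth l∼y) ⟩
    T (truth y)     ≈⟨ ≡-truth t∶ψ x'∶θ y∶ψ≡θ ⟩
    (t ≐ x') ∈ B    ≈⟨ mk⇔ (λ t≐x' → ≐-trans x∼t (≐-trans t≐x' (≐-sym z∼x')))
                           (λ x≐z → ≐-trans (≐-sym x∼t) (≐-trans x≐z z∼x')) ⟩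
    (x ≐ z) ∈ B     ≈⟨ rep-≐⇔≡ x∈ z∈ ⟩
    (⟨ x ⟩ ≡ ⟨ z ⟩) ∎
    where open ⇔-Reasoning

  eqv-total : ∀ a b → ∃[ u ] (InU u × EqvR a b u)
  eqv-total a b = cases-total (λ { (_ , refl , l∈ , _) → l∈ }) (∃binC1? _≡ᶠ_ a b)
    (a ≟ᵉ b ×-dec (a ≟ᵉ w⁺ ⊎-dec ¬? (binClosed? _≡ᶠ_ a b)))

  eqvC1-excludes-C2 : ∀ {a b u} → EqvC1 a b u → ¬ EqvC2 a b
  eqvC1-excludes-C2 {⟨ _ ⟩} {⟨ _ ⟩} c₁ (_ , inj₂ ¬closed) = ¬closed (binC1-closed _≡ᶠ_ c₁)

  eqv-functional : ∀ {a b u u'} → EqvR a b u → EqvR a b u' → u ≡ u'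
  eqv-functional = cases-functional (binC1-functional _≡ᶠ_ ≡-cong) eqvC1-excludes-C2

  eqv-designated : ∀ {a b u} → InU a → InU b → EqvR a b u → InD u ⇔ (a ≡ b)
  eqv-designated a∈ b∈ = cases-designated (eqvC1-designated a∈ b∈) proj₁
    (λ ¬c₁ a≡b → a≡b , inj₂ (λ ec → ¬c₁ (binClosed-C1 _≡ᶠ_ ec)))

  isSCI : IsSCI
  isSCI = record
    { nonempty = w⁺ , tt
    ; D⊆U      = λ { w⁺ _ → tt ; ⟨ pl _ ⟩ pl∈ → pl∈ }
    ; N-total  = λ a _ → neg-total a
    ; N-func   = λ _ _ _ _ → neg-functional
    ; I-total  = λ a b _ _ → imp-total a b
    ; I-func   = λ _ _ _ _ _ _ → imp-functional
    ; E-total  = λ a b _ _ → eqv-total a b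
    ; E-func   = λ _ _ _ _ _ _ → eqv-functional
    ; N-sem₁   = λ _ _ a∈ n → to (neg-designated a∈ n)
    ; N-sem₂   = λ _ _ a∈ n → from (neg-designated a∈ n)
    ; I-sem₁   = λ _ _ _ a∈ b∈ i → to (imp-designated a∈ b∈ i)
    ; I-sem₂   = λ _ _ _ a∈ b∈ i → from (imp-designated a∈ b∈ i)
    ; E-sem₁   = λ _ _ _ a∈ b∈ e → to (eqv-designated a∈ b∈ e)
    ; E-sem₂   = λ _ _ _ a∈ b∈ e → from (eqv-designated a∈ b∈ e)
    }

proposition10 : (φ : Fm) (r : ℕ) (S : St) →
    Star Step (rootSt r φ) S → Open S → FullyExpanded S →
    (ML : List Label) → IsML (items S) r ML →
    Model.IsSCI (items S) ML r
proposition10 φ r S _ isOpen (inj₁ closed) ML isML = contradiction closed isOpen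
proposition10 φ r S root⇝S _ (inj₂ stuck) ML isML = SCIModel.isSCI (items S) ML r saturated isML
  where
  saturated : Saturated (items S)
  saturated = stuck-saturated (star-preserves-DoneRealised root⇝S λ ()) stuck
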